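{- Let $A$ be a nonempty closed class of decision tables from $\mathcal{M}_k^2$ for which the function $S$ is not bounded from above. Then $F^W_{h,A}(n)=F^\Theta_{h,A}(n)=n$ for every $n\in\omega$.
   Context: Fix an integer $k\ge 2$; $\omega=\{0,1,2,\ldots\}$, $E_k=\{0,1,\ldots,k-1\}$, $E_2=\{0,1\}$. Let $P=\{f_i:i\in\omega\}$ be a set of attribute names ($f_i\ne f_j$ for $i\ne j$). $\mathcal{M}_k^2$ is the set of rectangular tables filled with numbers from $E_k$ whose columns are labeled with pairwise different attributes from $P$, whose rows are pairwise different, and in which each row is labeled with a decision from $E_2$; rows are tuples of values of the column attributes. Tables without rows also belong to $\mathcal{M}_k^2$ and are all denoted $\Lambda$. Tables differing only by a permutation of rows are equal. $P(T)$ is the set of column attributes of $T$. $\mathcal{M}_k^2\mathcal{C}$ is the set of tables in which all rows have the same decision ($\Lambda$ included). For $f_{i_1},\ldots,f_{i_m}\in P(T)$, $\delta_j\in E_k$, $T(f_{i_1},\delta_1)\cdots(f_{i_m},\delta_m)$ is the table of rows of $T$ having values $\delta_1,\ldots,\delta_m$ in the columns $f_{i_1},\ldots,f_{i_m}$. Operations: for $D\subseteq P(T)$, $I(D,T)$ deletes the columns labeled by $D$ and, in each group of rows coinciding on the remaining columns, keeps one row with the minimum decision; $I(P(T),T)=\Lambda$. For $\nu:E_k^{|P(T)|}\to E_2$, $J(\nu,T)$ replaces the decision of each row $\bar\delta$ by $\nu(\bar\delta)$. $[T]=\{J(\nu,I(D,T)):D\subseteq P(T),\nu:E_k^{|P(T)\setminus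 D|}\to E_2\}$; $[A]=\bigcup_{T\in A}[T]$; $A\ne\emptyset$ is a closed class if $[A]=A$. A test of $T$ is $D\subseteq P(T)$ such that any two rows with different decisions differ in some column labeled from $D$ (for $T\in\mathcal{M}_k^2\mathcal{C}$ every subset, including $\emptyset$, is a test). A $k$-decision tree is a finite directed rooted tree with at least two nodes, root and its leaving edges unlabeled, terminal nodes labeled with decisions from $E_2$, other nodes labeled with attributes from $P$ whose leaving edges are labeled with numbers from $E_k$. $P(\Gamma)$ is the set of attributes at nodes. For a complete path $\tau=v_1,d_1,\ldots,v_m,d_m,v_{m+1}$ from the root to a terminal node, its length in attribute nodes is $m-1$; $T(\tau)=T$ if $m=1$, else $T(f_{i_2},\delta_2)\cdots(f_{i_m},\delta_m)$ with $v_j$ labeled $f_{i_j}$ and $d_j$ labeled $\delta_j$. For $T\ne\Lambda$, a deterministic decision tree for $T$: exactly one edge leaves the root, edges leaving any other nonterminal node have pairwise different labels, $P(\Gamma)\subseteq P(T)$, every row of $T$ lies in some $T(\tau)$, and for every complete path either $T(\tau)=\Lambda$ or all rows of $T(\tau)$ have the terminal node's decision. The depth $h(\Gamma)$ is the maximum over complete paths of the number $m-1$ of attribute-labeled nodes on the path. For $T\ne\Lambda$: $h^d(T)$ is the minimum depth of a deterministic decision tree for $T$; $\Theta(T)$ is the minimum cardinality of a test of $T$; $W(T)$ is the number of columns of $T$; for a row $\bar\delta$, $S(T,\bar\delta)$ is the minimum cardinality of $D\subseteq P(T)$ such that on the columns labeled by $D$ the row $\bar\delta$ differs from all other rows, and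 $S(T)=\max_{\bar\delta}S(T,\bar\delta)$. All these are $0$ on $\Lambda$. $F^W_{h,A}(n)=\max\{h^d(T):T\in A,W(T)\le n\}$ and $F^\Theta_{h,A}(n)=\max\{h^d(T):T\in A,\Theta(T)\le n\}$. -}

module Defs where

open import Data.Nat using (ℕ; zero; suc; _≤_; _⊔_)
open import Data.Fin using (Fin) renaming (zero to fz; suc to fs)
import Data.Fin as F
open import Data.Bool using (Bool; true; false; if_then_else_)
open import Data.Maybe using (Maybe; just; nothing)
import Data.Maybe as M
open import Data.List using (List; []; _∷_; map; concatMap; allFin; foldr; filter)
open import Data.List.Relation.Unary.All using (All)
open import Data.List.Relation.Unary.Unique.Propositional using (Unique)
open import Data.List.Membership.Propositional using (_∈_)
open import Data.Vec using (Vec; lookup) renaming ([] to []v; _∷_ to _∷v_)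
open import Data.Vec.Properties using (≡-dec)
open import Data.Product using (Σ; ∃; ∃₂; _×_; _,_; proj₁; proj₂)
open import Data.Sum using (_⊎_)
open import Relation.Binary.PropositionalEquality using (_≡_; _≢_)
open import Relation.Nullary using (¬_; does)

-- Decision tables of M_k^2.
-- Attribute f_i is represented by the natural number i.
-- A table has `ncols` columns, labelled by `cols` (column attributes,
-- required pairwise distinct by `WF`), and its rows are given by the
-- partial function `dec`: a tuple r ∈ E_k^ncols is a row of the table
-- iff dec r ≡ just d, and d ∈ E_2 is then its decision.  (Hence rows are
-- automatically pairwise different, and row order is immaterial.)

E2 : Set
E2 = Fin 2

record Table (k : ℕ) : Set where
  constructor mkT
  field
    ncols : ℕ
    cols  : Vec ℕ ncols
    dec   : Vec (Fin k) ncols → Maybe E2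
open Table public

WF : ∀ {k} → Table k → Set
WF T = ∀ i j → lookup (cols T) i ≡ lookup (cols T) j → i ≡ j

IsΛ : ∀ {k} → Table k → Set
IsΛ T = ∀ r → dec T r ≡ nothing

IsRow : ∀ {k} (T : Table k) → Vec (Fin k) (ncols T) → Set
IsRow T r = ∃ λ b → dec T r ≡ just b

HasRow : ∀ {k} → Table k → Set
HasRow T = ∃ λ r → IsRow T r

-- Subsets of the set of columns: Vec Bool ncols (true = member)

card : ∀ {m} → Vec Bool m → ℕ
card []v = 0
card (true ∷v D) = suc (card D)
card (false ∷v D) = card D

nKeep : ∀ {m} → Vec Bool m → ℕ
nKeep []v = 0
nKeep (true ∷v D) = nKeep D
nKeep (false ∷v D) = suc (nKeep D)

restrict : ∀ {A : Set} {m} (D : Vec Bool m) → Vec A m → Vec A (nKeep D)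
restrict []v []v = []v
restrict (true ∷v D) (x ∷v xs) = restrict D xs
restrict (false ∷v D) (x ∷v xs) = x ∷v restrict D xs

allVecs : ∀ {k} (m : ℕ) → List (Vec (Fin k) m)
allVecs zero = []v ∷ []
allVecs {k} (suc m) = concatMap (λ x → map (x ∷v_) (allVecs m)) (allFin k)

min2 : E2 → E2 → E2
min2 fz _ = fz
min2 _ fz = fz
min2 x _ = x

minJust : List (Maybe E2) → Maybe E2
minJust = foldr comb nothing
  where
  comb : Maybe E2 → Maybe E2 → Maybe E2
  comb nothing y = y
  comb (just a) nothing = just a
  comb (just a) (just b) = just (min2 a b)

isZero : ℕ → Bool
isZero zero = true
isZero (suc _) = false

-- I(D,T): delete the columns in D; among rows coinciding on the
-- remaining columns keep one with minimum decision; I(P(T),T) = Λ.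
I : ∀ {k} (T : Table k) → Vec Bool (ncols T) → Table k
I {k} T D = mkT (nKeep D) (restrict D (cols T)) dec′
  where
  dec′ : Vec (Fin k) (nKeep D) → Maybe E2
  dec′ ρ = if isZero (nKeep D) then nothing
           else minJust (map (dec T)
                  (filter (λ r → ≡-dec F._≟_ (restrict D r) ρ) (allVecs (ncols T))))

J : ∀ {k} (T : Table k) → (Vec (Fin k) (ncols T) → E2) → Table k
J T ν = mkT (ncols T) (cols T) (λ r → M.map (λ _ → ν r) (dec T r))

ClosedClass : ∀ {k} → (Table k → Set) → Set
ClosedClass {k} A =
  (∀ T → A T → WF T) ×
  (Σ (Table k) A) ×
  (∀ T → A T → ∀ (D : Vec Bool (ncols T))
       (ν : Vec (Fin k) (ncols (I T D)) → E2) → A (J (I T D) ν))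

IsMin : (ℕ → Set) → ℕ → Set
IsMin P m = P m × (∀ m′ → P m′ → m ≤ m′)

IsTest : ∀ {k} (T : Table k) → Vec Bool (ncols T) → Set
IsTest T D = ∀ r r′ b b′ → dec T r ≡ just b → dec T r′ ≡ just b′ → b ≢ b′ →
  ∃ λ i → lookup D i ≡ true × lookup r i ≢ lookup r′ i

ThetaIs : ∀ {k} → Table k → ℕ → Set
ThetaIs T = IsMin (λ m → Σ (Vec Bool (ncols T)) λ D → IsTest T D × card D ≡ m)

Separates : ∀ {k} (T : Table k) → Vec (Fin k) (ncols T) → Vec Bool (ncols T) → Set
Separates T r D = ∀ r′ → IsRow T r′ → r′ ≢ r →
  ∃ λ i → lookup D i ≡ true × lookup r i ≢ lookup r′ i

SRowIs : ∀ {k} (T : Table k) → Vec (Fin k) (ncols T) → ℕ → Set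
SRowIs T r = IsMin (λ m → Σ (Vec Bool (ncols T)) λ D → Separates T r D × card D ≡ m)

SIs : ∀ {k} → Table k → ℕ → Set
SIs T s = (IsΛ T × s ≡ 0) ⊎
  ((∃ λ r → IsRow T r × SRowIs T r s) ×
   (∀ r → IsRow T r → ∀ m → SRowIs T r m → m ≤ s))

-- A tree is given by the node which the unique edge
-- leaving the (unlabelled) root enters.

data Node (k : ℕ) : Set where
  leaf : E2 → Node k
  attr : ℕ → List (Fin k × Node k) → Node k

data Det {k} : Node k → Set where
  leafD : ∀ b → Det (leaf b)
  attrD : ∀ f c cs → Unique (map proj₁ (c ∷ cs)) →
          All (λ p → Det (proj₂ p)) (c ∷ cs) → Det (attr f (c ∷ cs))

data AttrsIn {k} (S : ℕ → Set) : Node k → Set where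
  leafA : ∀ b → AttrsIn S (leaf b)
  attrA : ∀ f cs → S f → All (λ p → AttrsIn S (proj₂ p)) cs → AttrsIn S (attr f cs)

data CPath {k} : Node k → List (ℕ × Fin k) → E2 → Set where
  pleaf : ∀ b → CPath (leaf b) [] b
  pattr : ∀ f cs δ c π b → (δ , c) ∈ cs → CPath c π b →
          CPath (attr f cs) ((f , δ) ∷ π) b

mutual
  depth : ∀ {k} → Node k → ℕ
  depth (leaf _) = 0
  depth (attr _ cs) = suc (maxDepth cs)

  maxDepth : ∀ {k} → List (Fin k × Node k) → ℕ
  maxDepth [] = 0
  maxDepth ((_ , c) ∷ cs) = depth c ⊔ maxDepth cs

Consistent : ∀ {k} (T : Table k) → Vec (Fin k) (ncols T) → List (ℕ × Fin k) → Set
Consistent T r π =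
  All (λ p → ∀ i → lookup (cols T) i ≡ proj₁ p → lookup r i ≡ proj₂ p) π

record IsDTree {k} (T : Table k) (Γ : Node k) : Set where
  field
    det     : Det Γ
    attrs   : AttrsIn (λ f → ∃ λ i → lookup (cols T) i ≡ f) Γ
    cover   : ∀ r → IsRow T r → ∃₂ λ π b′ → CPath Γ π b′ × Consistent T r π
    correct : ∀ π b′ → CPath Γ π b′ → ∀ r b → dec T r ≡ just b →
              Consistent T r π → b ≡ b′

HdIs : ∀ {k} → Table k → ℕ → Set
HdIs T h = (IsΛ T × h ≡ 0) ⊎
  (HasRow T × IsMin (λ m → ∃ λ Γ → IsDTree T Γ × depth Γ ≡ m) h)

FWIs : ∀ {k} → (Table k → Set) → ℕ → ℕ → Set
FWIs {k} A n v =
  (Σ (Table k) λ T → A T × ncols T ≤ n × HdIs T v) ×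
  (∀ T → A T → ncols T ≤ n → ∀ h → HdIs T h → h ≤ v)

FΘIs : ∀ {k} → (Table k → Set) → ℕ → ℕ → Set
FΘIs {k} A n v =
  (Σ (Table k) λ T → A T × (∃ λ θ → ThetaIs T θ × θ ≤ n) × HdIs T v) ×
  (∀ T → A T → ∀ θ → ThetaIs T θ → θ ≤ n → ∀ h → HdIs T h → h ≤ v)

SUnbounded : ∀ {k} → (Table k → Set) → Set
SUnbounded {k} A = ∀ m → Σ (Table k) λ T → A T × ∃ λ s → SIs T s × m ≤ s

{-# OPTIONS --safe #-}
module Submission where

-- Querying the columns of a test one by one gives a decision tree, so
-- h^d(T) ≤ Θ(T) ≤ W(T).  Conversely, if S(T, r) ≥ n > 0 then a minimal set D₀
-- separating r from the other rows contains, for each of its columns i, a row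
-- agreeing with r on D₀ except at i.  Keeping n columns of D₀ (operation I) and
-- giving decision 1 exactly to the image of r (operation J) yields a table of A
-- in which every column must be queried and belongs to every test, so that
-- h^d = Θ = W = n; for n = 0 the empty table, obtained by deleting all columns,
-- does.

open import Defs
open import Data.Nat using (ℕ; zero; suc; _≤_; z≤n; s≤s; _≟_)
import Data.Nat.Properties as ℕ
open import Data.Fin using (Fin) renaming (zero to fz; suc to fs)
import Data.Fin as F
import Data.Fin.Properties as FP
open import Data.Bool using (Bool; true; false; not)
import Data.Bool as B
import Data.Bool.Properties as BP
open import Data.Maybe using (Maybe; just; nothing)
import Data.Maybe.Properties as MP
open import Data.List using (List; []; _∷_; map; allFin; length)
import Data.List as L
import Data.List.Properties as LP
open import Data.List.Relation.Unary.All using (All; []; _∷_)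
import Data.List.Relation.Unary.All as All
import Data.List.Relation.Unary.All.Properties as AllP
open import Data.List.Relation.Unary.Any using (Any; here; there)
import Data.List.Relation.Unary.Any as Any
import Data.List.Relation.Unary.Any.Properties as AnyP
open import Data.List.Relation.Unary.Unique.Propositional using (Unique)
open import Data.List.Relation.Unary.Unique.Propositional.Properties using (allFin⁺)
open import Data.List.Membership.Propositional using (_∈_)
open import Data.List.Membership.Propositional.Properties
  using (∈-map⁺; ∈-map⁻; ∈-allFin; ∈-concatMap⁺; ∈-filter⁺)
open import Data.Vec using (Vec; lookup; replicate; _[_]≔_) renaming ([] to []v; _∷_ to _∷v_)
import Data.Vec as V
import Data.Vec.Properties as VP
open import Data.Product using (Σ; ∃; ∃₂; _×_; _,_; proj₁; proj₂)
open import Data.Sum using (_⊎_; inj₁; inj₂)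
open import Data.Empty using (⊥-elim)
open import Function using (_∘_; case_of_)
open import Relation.Binary.PropositionalEquality
  using (_≡_; _≢_; refl; sym; trans; cong; subst; module ≡-Reasoning)
open import Relation.Nullary using (¬_; Dec; yes; no)
open import Relation.Nullary.Decidable using (_×-dec_; _→-dec_; ¬?)

one : E2
one = fs fz

indicator : ∀ {P : Set} → Dec P → E2
indicator (yes _) = one
indicator (no _)  = fz

_⊆_ : ∀ {m} → Vec Bool m → Vec Bool m → Set
E ⊆ D = ∀ j → lookup E j ≡ true → lookup D j ≡ true

card-replicate-true : ∀ m → card (replicate m true) ≡ m
card-replicate-true zero    = refl
card-replicate-true (suc m) = cong suc (card-replicate-true m)

card-replicate-false : ∀ m → card (replicate m false) ≡ 0
card-replicate-false zero    = refl
card-replicate-false (suc m) = card-replicate-false m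

nKeep-replicate-true : ∀ m → nKeep (replicate m true) ≡ 0
nKeep-replicate-true zero    = refl
nKeep-replicate-true (suc m) = nKeep-replicate-true m

card-full : ∀ {m} (D : Vec Bool m) → (∀ j → lookup D j ≡ true) → card D ≡ m
card-full []v          _   = refl
card-full (true ∷v D)  all = cong suc (card-full D (λ j → all (fs j)))
card-full (false ∷v D) all with all fz
... | ()

card-remove : ∀ {m} (D : Vec Bool m) i → lookup D i ≡ true → suc (card (D [ i ]≔ false)) ≡ card D
card-remove (true ∷v D)  fz     refl = refl
card-remove (true ∷v D)  (fs i) Di   = cong suc (card-remove D i Di)
card-remove (false ∷v D) (fs i) Di   = card-remove D i Di

subsetOfCard : ∀ {m} n (D : Vec Bool m) → n ≤ card D → Σ (Vec Bool m) λ E → E ⊆ D × card E ≡ n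
subsetOfCard {m} zero D _ = replicate m false , empty⊆ , card-replicate-false m
  where
  empty⊆ : replicate m false ⊆ D
  empty⊆ j Ej with trans (sym (VP.lookup-replicate j false)) Ej
  ... | ()
subsetOfCard (suc n) (true ∷v D) (s≤s n≤D) with subsetOfCard n D n≤D
... | E , E⊆D , cardE = true ∷v E , (λ { fz _ → refl ; (fs j) → E⊆D j }) , cong suc cardE
subsetOfCard (suc n) (false ∷v D) n≤D with subsetOfCard (suc n) D n≤D
... | E , E⊆D , cardE = false ∷v E , (λ { fz () ; (fs j) → E⊆D j }) , cardE

members : ∀ {m} → Vec Bool m → List (Fin m)
members []v          = []
members (true ∷v D)  = fz ∷ map fs (members D)
members (false ∷v D) = map fs (members D)

length-members : ∀ {m} (D : Vec Bool m) → length (members D) ≡ card D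
length-members []v          = refl
length-members (true ∷v D)  = cong suc (trans (LP.length-map fs (members D)) (length-members D))
length-members (false ∷v D) = trans (LP.length-map fs (members D)) (length-members D)

∈-members : ∀ {m} (D : Vec Bool m) {i} → lookup D i ≡ true → i ∈ members D
∈-members (true ∷v D)  {fz}   _  = here refl
∈-members (true ∷v D)  {fs i} Di = there (∈-map⁺ fs (∈-members D Di))
∈-members (false ∷v D) {fs i} Di = ∈-map⁺ fs (∈-members D Di)

nKeep-complement : ∀ {m} (E : Vec Bool m) → nKeep (V.map not E) ≡ card E
nKeep-complement []v          = refl
nKeep-complement (true ∷v E)  = cong suc (nKeep-complement E)
nKeep-complement (false ∷v E) = nKeep-complement E

keptIndex : ∀ {m} (D : Vec Bool m) → Fin (nKeep D) → Fin m
keptIndex (true ∷v D)  j      = fs (keptIndex D j)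
keptIndex (false ∷v D) fz     = fz
keptIndex (false ∷v D) (fs j) = fs (keptIndex D j)

lookup-restrict : ∀ {A : Set} {m} (D : Vec Bool m) (v : Vec A m) j →
                  lookup (restrict D v) j ≡ lookup v (keptIndex D j)
lookup-restrict (true ∷v D)  (x ∷v v) j      = lookup-restrict D v j
lookup-restrict (false ∷v D) (x ∷v v) fz     = refl
lookup-restrict (false ∷v D) (x ∷v v) (fs j) = lookup-restrict D v j

lookup-keptIndex : ∀ {m} (D : Vec Bool m) j → lookup D (keptIndex D j) ≡ false
lookup-keptIndex (true ∷v D)  j      = lookup-keptIndex D j
lookup-keptIndex (false ∷v D) fz     = refl
lookup-keptIndex (false ∷v D) (fs j) = lookup-keptIndex D j

keptIndex-injective : ∀ {m} (D : Vec Bool m) {j j′} → keptIndex D j ≡ keptIndex D j′ → j ≡ j′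
keptIndex-injective (true ∷v D)  eq = keptIndex-injective D (FP.suc-injective eq)
keptIndex-injective (false ∷v D) {fz}   {fz}    _  = refl
keptIndex-injective (false ∷v D) {fs j} {fs j′} eq =
  cong fs (keptIndex-injective D (FP.suc-injective eq))

allVecs-complete : ∀ {k} m (v : Vec (Fin k) m) → v ∈ allVecs m
allVecs-complete zero    []v      = here refl
allVecs-complete (suc m) (x ∷v v) =
  ∈-concatMap⁺ (λ x → map (x ∷v_) (allVecs m))
    (Any.map (λ { refl → ∈-map⁺ (x ∷v_) (allVecs-complete m v) }) (∈-allFin x))

≢⇒lookup≢ : ∀ {k m} {r r′ : Vec (Fin k) m} → r ≢ r′ → ∃ λ i → lookup r i ≢ lookup r′ i
≢⇒lookup≢ {m = m} {r} {r′} r≢r′ =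
  FP.¬∀⟶∃¬ m (λ i → lookup r i ≡ lookup r′ i) (λ i → lookup r i F.≟ lookup r′ i) λ r≗r′ →
    r≢r′ (trans (sym (VP.tabulate∘lookup r))
           (trans (VP.tabulate-cong r≗r′) (VP.tabulate∘lookup r′)))

isRow? : ∀ {k} (T : Table k) r → Dec (IsRow T r)
isRow? T r with dec T r
... | just b  = yes (b , refl)
... | nothing = no λ ()

full-isTest : ∀ {k} (T : Table k) → IsTest T (replicate (ncols T) true)
full-isTest T r r′ b b′ r↦b r′↦b′ b≢b′ =
  let i , ri≢r′i = ≢⇒lookup≢ r≢r′ in i , VP.lookup-replicate i true , ri≢r′i
  where
  r≢r′ : r ≢ r′
  r≢r′ refl = b≢b′ (MP.just-injective (trans (sym r↦b) r′↦b′))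

minJust-just : ∀ {b} xs → just b ∈ xs → ∃ λ c → minJust xs ≡ just c
minJust-just (just a ∷ xs) _ with minJust xs
... | nothing = a , refl
... | just c  = min2 a c , refl
minJust-just (nothing ∷ xs) (there b∈xs) = minJust-just xs b∈xs

isZero-≢0 : ∀ {n} → n ≢ 0 → isZero n ≡ false
isZero-≢0 {zero}  n≢0 = ⊥-elim (n≢0 refl)
isZero-≢0 {suc n} _   = refl

isZero-≡0 : ∀ {n} → n ≡ 0 → isZero n ≡ true
isZero-≡0 refl = refl

I-isRow : ∀ {k} (T : Table k) (D : Vec Bool (ncols T)) → nKeep D ≢ 0 →
          ∀ {r} → IsRow T r → IsRow (I T D) (restrict D r)
I-isRow {k} T D some-kept {r} (b , r↦b) rewrite isZero-≢0 some-kept =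
  minJust-just decisions
    (subst (_∈ decisions) r↦b (∈-map⁺ (dec T) (∈-filter⁺ sameImage? (allVecs-complete _ r) refl)))
  where
  sameImage? : ∀ r′ → Dec (restrict D r′ ≡ restrict D r)
  sameImage? r′ = VP.≡-dec F._≟_ (restrict D r′) (restrict D r)

  decisions : List (Maybe E2)
  decisions = map (dec T) (L.filter sameImage? (allVecs (ncols T)))

I-full-isΛ : ∀ {k} (T : Table k) → IsΛ (I T (replicate (ncols T) true))
I-full-isΛ T _ rewrite isZero-≡0 (nKeep-replicate-true (ncols T)) = refl

J-isΛ : ∀ {k} {T : Table k} ν → IsΛ T → IsΛ (J T ν)
J-isΛ ν isΛ r rewrite isΛ r = refl

J-dec : ∀ {k} (T : Table k) ν {r} → IsRow T r → dec (J T ν) r ≡ just (ν r)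
J-dec T ν (b , r↦b) rewrite r↦b = refl

hd≤depth : ∀ {k} {T : Table k} {h Γ} → HdIs T h → IsDTree T Γ → h ≤ depth Γ
hd≤depth (inj₁ (_ , refl))         _ = z≤n
hd≤depth (inj₂ (_ , (_ , minimal))) Γ-tree = minimal _ (_ , Γ-tree , refl)

depth≤maxDepth : ∀ {k} {δ : Fin k} {c cs} → (δ , c) ∈ cs → depth c ≤ maxDepth cs
depth≤maxDepth (here refl) = ℕ.m≤m⊔n _ _
depth≤maxDepth {cs = (_ , c′) ∷ _} (there c∈cs) =
  ℕ.≤-trans (depth≤maxDepth c∈cs) (ℕ.m≤n⊔m (depth c′) _)

length≤depth : ∀ {k} {Γ : Node k} {π b} → CPath Γ π b → length π ≤ depth Γ
length≤depth (pleaf _)               = z≤n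
length≤depth (pattr _ _ _ _ _ _ c∈cs p) = s≤s (ℕ.≤-trans (length≤depth p) (depth≤maxDepth c∈cs))

-- The tree queries the columns of a test one after the other; a leaf answers 1
-- iff some row of decision 1 agrees with the values read along its path.
module TestTree {k} (T : Table (suc k)) where

  Assignment : Set
  Assignment = List (Fin (ncols T) × Fin (suc k))

  Satisfies : Vec (Fin (suc k)) (ncols T) → Assignment → Set
  Satisfies r = All (λ p → lookup r (proj₁ p) ≡ proj₂ p)

  SatisfiedByOne : Assignment → Set
  SatisfiedByOne acc = Any (λ r → dec T r ≡ just one × Satisfies r acc) (allVecs (ncols T))

  satisfiedByOne? : ∀ acc → Dec (SatisfiedByOne acc)
  satisfiedByOne? acc = Any.any? (λ r → MP.≡-dec F._≟_ (dec T r) (just one) ×-dec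
    All.all? (λ p → lookup r (proj₁ p) F.≟ proj₂ p) acc) (allVecs (ncols T))

  mutual
    build : List (Fin (ncols T)) → Assignment → Node (suc k)
    build []       acc = leaf (indicator (satisfiedByOne? acc))
    build (i ∷ qs) acc = attr (lookup (cols T) i) (branches qs acc i)

    branches : List (Fin (ncols T)) → Assignment → Fin (ncols T) → List (Fin (suc k) × Node (suc k))
    branches qs acc i = map (λ δ → δ , build qs ((i , δ) ∷ acc)) (allFin (suc k))

  record Reached (qs : List (Fin (ncols T))) (acc : Assignment)
                 (π : List (ℕ × Fin (suc k))) (b : E2) : Set where
    field
      final     : Assignment
      label≡    : b ≡ indicator (satisfiedByOne? final)
      satisfies : ∀ r → Satisfies r acc → Consistent T r π → Satisfies r final
      extends   : ∀ {p} → p ∈ acc → p ∈ final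
      covers    : ∀ {i} → i ∈ qs → ∃ λ δ → (i , δ) ∈ final

  reached : ∀ qs acc {π b} → CPath (build qs acc) π b → Reached qs acc π b
  reached [] acc (pleaf _) = record
    { final = acc ; label≡ = refl ; satisfies = λ _ sat _ → sat ; extends = λ p → p ; covers = λ () }
  reached (i ∷ qs) acc (pattr _ _ δ _ π _ δ∈ p) with ∈-map⁻ _ δ∈
  ... | δ′ , _ , refl = record
    { final     = final
    ; label≡    = label≡
    ; satisfies = λ r sat cons → satisfies r (All.head cons i refl ∷ sat) (All.tail cons)
    ; extends   = λ p → extends (there p)
    ; covers    = λ { (here refl) → δ′ , extends (here refl) ; (there i∈qs) → covers i∈qs }
    }
    where open Reached (reached qs ((i , δ′) ∷ acc) p)

  covering-path : WF T → ∀ qs acc r → ∃₂ λ π b → CPath (build qs acc) π b × Consistent T r π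
  covering-path wf []       acc r = [] , _ , pleaf _ , []
  covering-path wf (i ∷ qs) acc r with covering-path wf qs ((i , lookup r i) ∷ acc) r
  ... | π , b , p , cons =
    (lookup (cols T) i , lookup r i) ∷ π , b ,
    pattr _ _ _ _ π b (∈-map⁺ _ (∈-allFin (lookup r i))) p ,
    (λ j same → cong (lookup r) (wf j i same)) ∷ cons

  all-branches : ∀ {P : Node (suc k) → Set} qs acc i → (∀ acc′ → P (build qs acc′)) →
                 All (λ c → P (proj₂ c)) (branches qs acc i)
  all-branches qs acc i P-build = AllP.map⁺ (All.tabulate λ _ → P-build _)

  build-det : ∀ qs acc → Det (build qs acc)
  build-det []       acc = leafD _
  build-det (i ∷ qs) acc =
    attrD _ _ _ (subst Unique (sym labels≡) (allFin⁺ (suc k))) (all-branches qs acc i (build-det qs))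
    where
    labels≡ : map proj₁ (branches qs acc i) ≡ allFin (suc k)
    labels≡ = trans (sym (LP.map-∘ (allFin (suc k)))) (LP.map-id (allFin (suc k)))

  build-attrs : ∀ qs acc → AttrsIn (λ f → ∃ λ i → lookup (cols T) i ≡ f) (build qs acc)
  build-attrs []       acc = leafA _
  build-attrs (i ∷ qs) acc = attrA _ _ (i , refl) (all-branches qs acc i (build-attrs qs))

  build-depth : ∀ qs acc → depth (build qs acc) ≤ length qs
  build-depth []       acc = z≤n
  build-depth (i ∷ qs) acc = s≤s (maxDepth-branches (allFin (suc k)))
    where
    maxDepth-branches : ∀ δs → maxDepth (map (λ δ → δ , build qs ((i , δ) ∷ acc)) δs) ≤ length qs
    maxDepth-branches []       = z≤n
    maxDepth-branches (δ ∷ δs) = ℕ.⊔-lub (build-depth qs _) (maxDepth-branches δs)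

  module _ (D : Vec Bool (ncols T)) (test : IsTest T D) where

    decision≡label : ∀ acc → (∀ {i} → lookup D i ≡ true → ∃ λ δ → (i , δ) ∈ acc) →
                     ∀ r b → dec T r ≡ just b → Satisfies r acc →
                     b ≡ indicator (satisfiedByOne? acc)
    decision≡label acc covers r b r↦b sat with satisfiedByOne? acc
    ... | no none with b
    ...   | fz    = refl
    ...   | fs fz = ⊥-elim (none (Any.map (λ { refl → r↦b , sat }) (allVecs-complete _ r)))
    decision≡label acc covers r b r↦b sat | yes some with Any.satisfied some | b F.≟ one
    ... | _        | yes b≡1 = b≡1
    ... | r₁ , r₁↦1 , sat₁ | no b≢1 with test r r₁ b one r↦b r₁↦1 b≢1
    ... | i , Di , ri≢r₁i with covers Di
    ... | δ , iδ∈ = ⊥-elim (ri≢r₁i (trans (All.lookup sat iδ∈) (sym (All.lookup sat₁ iδ∈))))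

    test⇒tree : WF T → ∃ λ Γ → IsDTree T Γ × depth Γ ≤ card D
    test⇒tree wf = build (members D) [] ,
      record
        { det     = build-det _ _
        ; attrs   = build-attrs _ _
        ; cover   = λ r _ → covering-path wf (members D) [] r
        ; correct = λ π b′ p r b r↦b cons →
            let open Reached (reached (members D) [] p) in
            trans (decision≡label final (λ Di → covers (∈-members D Di)) r b r↦b (satisfies r [] cons))
                  (sym label≡)
        } ,
      subst (depth (build (members D) []) ≤_) (length-members D) (build-depth (members D) [])

hd≤test : ∀ {k} {T : Table (suc k)} {h} → WF T → ∀ D → IsTest T D → HdIs T h → h ≤ card D
hd≤test wf D test hd =
  let _ , Γ-tree , depth≤ = TestTree.test⇒tree _ D test wf in ℕ.≤-trans (hd≤depth hd Γ-tree) depth≤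

injective⇒≤length : ∀ {A : Set} {N} (g : Fin N → A) → (∀ {i j} → g i ≡ g j → i ≡ j) →
                    (xs : List A) → (∀ j → g j ∈ xs) → N ≤ length xs
injective⇒≤length g g-inj xs g∈xs =
  FP.injective⇒≤ {f = λ j → Any.index (g∈xs j)} λ {i} {j} same →
    g-inj (trans (AnyP.lookup-index (g∈xs i))
            (trans (cong (L.lookup xs) same) (sym (AnyP.lookup-index (g∈xs j)))))

-- Every column has to be read to tell the centre from its neighbours, so every
-- decision tree is as deep, and every test as large, as the table is wide.
record Star {k} (U : Table k) : Set where
  field
    centre      : Vec (Fin k) (ncols U)
    centre-dec  : dec U centre ≡ just one
    nbr         : Fin (ncols U) → Vec (Fin k) (ncols U)
    nbr-dec     : ∀ j → dec U (nbr j) ≡ just fz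
    nbr-differs : ∀ j → lookup (nbr j) j ≢ lookup centre j
    nbr-agrees  : ∀ j {j′} → j′ ≢ j → lookup (nbr j) j′ ≡ lookup centre j′

module _ {k} {U : Table k} (wf : WF U) (star : Star U) where
  open Star star

  star⇒ncols≤depth : ∀ {Γ} → IsDTree U Γ → ncols U ≤ depth Γ
  star⇒ncols≤depth {Γ} Γ-tree with IsDTree.cover Γ-tree centre (one , centre-dec)
  ... | π , b , p , cons = ℕ.≤-trans
    (injective⇒≤length (lookup (cols U)) (wf _ _) (map proj₁ π) read)
    (subst (_≤ depth Γ) (sym (LP.length-map proj₁ π)) (length≤depth p))
    where
    read : ∀ j → lookup (cols U) j ∈ map proj₁ π
    read j with Any.any? (λ f → lookup (cols U) j ≟ f) (map proj₁ π)
    ... | yes j-read = j-read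
    ... | no unread = ⊥-elim (0≢1 (trans (IsDTree.correct Γ-tree π b p (nbr j) fz (nbr-dec j) nbr-cons)
                                        (sym (IsDTree.correct Γ-tree π b p centre one centre-dec cons))))
      where
      0≢1 : fz ≢ one
      0≢1 ()
      nbr-cons : Consistent U (nbr j) π
      nbr-cons = All.tabulate λ {q} q∈π i i↦q → case i F.≟ j of λ
        { (yes refl) → ⊥-elim (unread (subst (_∈ map proj₁ π) (sym i↦q) (∈-map⁺ proj₁ q∈π)))
        ; (no i≢j)   → trans (nbr-agrees j i≢j) (All.lookup cons q∈π i i↦q) }

  star⇒test-full : ∀ D → IsTest U D → ∀ j → lookup D j ≡ true
  star⇒test-full D test j with test centre (nbr j) one fz centre-dec (nbr-dec j) (λ ())
  ... | i , Di , differ with i F.≟ j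
  ... | yes refl = Di
  ... | no i≢j   = ⊥-elim (differ (sym (nbr-agrees j i≢j)))

  star⇒Θ≡ncols : ThetaIs U (ncols U)
  star⇒Θ≡ncols = (replicate _ true , full-isTest U , card-replicate-true _) ,
    λ { _ (D , test , refl) → ℕ.≤-reflexive (sym (card-full D (star⇒test-full D test))) }

module _ {k} {U : Table (suc k)} (wf : WF U) (star : Star U) where

  star⇒hd≡ncols : HdIs U (ncols U)
  star⇒hd≡ncols with TestTree.test⇒tree U (replicate _ true) (full-isTest U) wf
  ... | Γ , Γ-tree , depth≤ = inj₂ ((Star.centre star , one , Star.centre-dec star) ,
    (Γ , Γ-tree , ℕ.≤-antisym (subst (depth Γ ≤_) (card-replicate-true _) depth≤)
                              (star⇒ncols≤depth wf star Γ-tree)) ,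
    λ { _ (_ , Γ′-tree , refl) → star⇒ncols≤depth wf star Γ′-tree })

Agree : ∀ {k m} → Vec Bool m → Vec (Fin k) m → Vec (Fin k) m → Set
Agree D r r′ = ∀ j → lookup D j ≡ true → lookup r j ≡ lookup r′ j

agree? : ∀ {k m} D (r r′ : Vec (Fin k) m) → Dec (Agree D r r′)
agree? D r r′ = FP.all? λ j → (lookup D j B.≟ true) →-dec (lookup r j F.≟ lookup r′ j)

¬Agree⇒differ : ∀ {k m} D (r r′ : Vec (Fin k) m) → ¬ Agree D r r′ →
                ∃ λ j → lookup D j ≡ true × lookup r j ≢ lookup r′ j
¬Agree⇒differ D r r′ disagree
  with FP.¬∀⟶∃¬ _ _ (λ j → (lookup D j B.≟ true) →-dec (lookup r j F.≟ lookup r′ j)) disagree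
... | j , disagree-at-j with lookup D j B.≟ true
... | yes Dj = j , Dj , λ same → disagree-at-j λ _ → same
... | no ¬Dj = ⊥-elim (disagree-at-j λ Dj → ⊥-elim (¬Dj Dj))

separates-or-confusable : ∀ {k} (T : Table k) r D →
  Separates T r D ⊎ ∃ λ r′ → IsRow T r′ × r′ ≢ r × Agree D r r′
separates-or-confusable T r D
  with Any.any? (λ r′ → isRow? T r′ ×-dec ¬? (VP.≡-dec F._≟_ r′ r) ×-dec agree? D r r′)
                (allVecs (ncols T))
... | yes some = inj₂ (Any.satisfied some)
... | no none  = inj₁ λ r′ row r′≢r → ¬Agree⇒differ D r r′ λ agree →
  none (Any.map (λ { refl → row , r′≢r , agree }) (allVecs-complete _ r′))

record Neighbour {k} (T : Table k) (r : Vec (Fin k) (ncols T)) (D₀ : Vec Bool (ncols T))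
                 (i : Fin (ncols T)) : Set where
  field
    row     : Vec (Fin k) (ncols T)
    isRow   : IsRow T row
    differs : lookup row i ≢ lookup r i
    agrees  : ∀ {j} → j ≢ i → lookup D₀ j ≡ true → lookup row j ≡ lookup r j

-- By minimality, D₀ with column i removed no longer separates r; the row it
-- fails to separate differs from r inside D₀ only in column i.
minimal-separator-neighbour :
  ∀ {k} (T : Table k) {r D₀} → Separates T r D₀ → (∀ D → Separates T r D → card D₀ ≤ card D) →
  ∀ {i} → lookup D₀ i ≡ true → Neighbour T r D₀ i
minimal-separator-neighbour T {r} {D₀} sep minimal {i} D₀i
  with separates-or-confusable T r (D₀ [ i ]≔ false)
... | inj₁ sep′ =
  ⊥-elim (ℕ.<-irrefl (sym (card-remove D₀ i D₀i)) (s≤s (minimal (D₀ [ i ]≔ false) sep′)))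
... | inj₂ (r′ , row , r′≢r , agree) with sep r′ row r′≢r
... | j , D₀j , rj≢r′j with j F.≟ i
... | yes refl = record
  { row     = r′
  ; isRow   = row
  ; differs = λ same → rj≢r′j (sym same)
  ; agrees  = λ j≢i D₀j → sym (agree _ (trans (VP.lookup∘update′ j≢i D₀ false) D₀j))
  }
... | no j≢i   = ⊥-elim (rj≢r′j (agree j (trans (VP.lookup∘update′ j≢i D₀ false) D₀j)))

-- Keep suc n columns of a minimal separating set of r and relabel so that
-- exactly the image of r has decision 1: the neighbours of r become the star.
module SeparatorToStar {k} (T : Table k) {r} (row : IsRow T r)
  (D₀ : Vec Bool (ncols T)) (sep : Separates T r D₀)
  (minimal : ∀ D → Separates T r D → card D₀ ≤ card D)
  (n : ℕ) (n<D₀ : suc n ≤ card D₀) where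

  kept : Vec Bool (ncols T)
  kept = proj₁ (subsetOfCard (suc n) D₀ n<D₀)

  deleted : Vec Bool (ncols T)
  deleted = V.map not kept

  ncols≡ : nKeep deleted ≡ suc n
  ncols≡ = trans (nKeep-complement kept) (proj₂ (proj₂ (subsetOfCard (suc n) D₀ n<D₀)))

  centre : Vec (Fin k) (nKeep deleted)
  centre = restrict deleted r

  ν : Vec (Fin k) (nKeep deleted) → E2
  ν ρ = indicator (VP.≡-dec F._≟_ ρ centre)

  U : Table k
  U = J (I T deleted) ν

  U-dec : ∀ {r′} → IsRow T r′ → dec U (restrict deleted r′) ≡ just (ν (restrict deleted r′))
  U-dec = J-dec (I T deleted) ν ∘ I-isRow T deleted (λ n+1≡0 → ℕ.1+n≢0 (trans (sym ncols≡) n+1≡0))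

  ν-centre : ν centre ≡ one
  ν-centre with VP.≡-dec F._≟_ centre centre
  ... | yes _     = refl
  ... | no ≢centre = ⊥-elim (≢centre refl)

  ν-≢centre : ∀ {ρ} → ρ ≢ centre → ν ρ ≡ fz
  ν-≢centre {ρ} ρ≢centre with VP.≡-dec F._≟_ ρ centre
  ... | yes ρ≡centre = ⊥-elim (ρ≢centre ρ≡centre)
  ... | no _         = refl

  kept-in-D₀ : ∀ j → lookup D₀ (keptIndex deleted j) ≡ true
  kept-in-D₀ j = proj₁ (proj₂ (subsetOfCard (suc n) D₀ n<D₀)) _
    (BP.not-injective (trans (sym (VP.lookup-map _ not kept)) (lookup-keptIndex deleted j)))

  neighbour : ∀ j → Neighbour T r D₀ (keptIndex deleted j)
  neighbour j = minimal-separator-neighbour T sep minimal (kept-in-D₀ j)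

  nbr : Fin (nKeep deleted) → Vec (Fin k) (nKeep deleted)
  nbr j = restrict deleted (Neighbour.row (neighbour j))

  nbr-differs : ∀ j → lookup (nbr j) j ≢ lookup centre j
  nbr-differs j same = Neighbour.differs (neighbour j)
    (trans (sym (lookup-restrict deleted _ j)) (trans same (lookup-restrict deleted r j)))

  nbr-agrees : ∀ j {j′} → j′ ≢ j → lookup (nbr j) j′ ≡ lookup centre j′
  nbr-agrees j {j′} j′≢j = begin
    lookup (nbr j) j′                        ≡⟨ lookup-restrict deleted _ j′ ⟩
    lookup (Neighbour.row (neighbour j)) (keptIndex deleted j′)
      ≡⟨ Neighbour.agrees (neighbour j) (j′≢j ∘ keptIndex-injective deleted) (kept-in-D₀ j′) ⟩
    lookup r (keptIndex deleted j′)          ≡⟨ lookup-restrict deleted r j′ ⟨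
    lookup centre j′                         ∎
    where open ≡-Reasoning

  star : Star U
  star = record
    { centre      = centre
    ; centre-dec  = trans (U-dec row) (cong just ν-centre)
    ; nbr         = nbr
    ; nbr-dec     = λ j → trans (U-dec (Neighbour.isRow (neighbour j)))
                                (cong just (ν-≢centre λ eq → nbr-differs j (cong (λ v → lookup v j) eq)))
    ; nbr-differs = nbr-differs
    ; nbr-agrees  = nbr-agrees
    }

separator⇒star :
  ∀ {k} {A : Table k → Set} → ClosedClass A → ∀ {T} → A T → ∀ {r} → IsRow T r →
  ∀ D₀ → Separates T r D₀ → (∀ D → Separates T r D → card D₀ ≤ card D) →
  ∀ n → suc n ≤ card D₀ → Σ (Table k) λ U → A U × ncols U ≡ suc n × Star U
separator⇒star (_ , _ , closed-IJ) {T} AT row D₀ sep minimal n n<D₀ =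
  U , closed-IJ T AT deleted ν , ncols≡ , star
  where open SeparatorToStar T row D₀ sep minimal n n<D₀

extremal-table : ∀ {k} {A : Table (suc k) → Set} → ClosedClass A → SUnbounded A →
  ∀ n → Σ (Table (suc k)) λ U → A U × ncols U ≡ n × HdIs U n × ThetaIs U n
extremal-table {k} (_ , (T₀ , AT₀) , closed-IJ) _ zero =
  Λ₀ , closed-IJ T₀ AT₀ all (λ _ → fz) , nKeep-replicate-true (ncols T₀) ,
  inj₁ (Λ₀-isΛ , refl) , Θ≡0
  where
  all : Vec Bool (ncols T₀)
  all = replicate (ncols T₀) true

  Λ₀ : Table (suc k)
  Λ₀ = J (I T₀ all) (λ _ → fz)

  Λ₀-isΛ : IsΛ Λ₀
  Λ₀-isΛ = J-isΛ {T = I T₀ all} (λ _ → fz) (I-full-isΛ T₀)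

  Θ≡0 : ThetaIs Λ₀ 0
  Θ≡0 = (replicate (ncols Λ₀) false , no-rows , card-replicate-false (ncols Λ₀)) , λ _ _ → z≤n
    where
    no-rows : IsTest Λ₀ (replicate (ncols Λ₀) false)
    no-rows r _ _ _ r↦b with trans (sym (Λ₀-isΛ r)) r↦b
    ... | ()
extremal-table closed@(wfA , _) unbounded (suc n) with unbounded (suc n)
... | _ , _ , _ , inj₁ (_ , refl) , ()
... | T , AT , _ , inj₂ ((r , row , (D₀ , sep , refl) , minimal) , _) , n<D₀
  with separator⇒star closed AT row D₀ sep (λ D sep′ → minimal _ (D , sep′ , refl)) n n<D₀
... | U , AU , ncols≡ , star = U , AU , ncols≡ ,
  subst (HdIs U) ncols≡ (star⇒hd≡ncols (wfA U AU) star) ,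
  subst (ThetaIs U) ncols≡ (star⇒Θ≡ncols (wfA U AU) star)

hd≤ncols : ∀ {k} {T : Table (suc k)} {h} → WF T → HdIs T h → h ≤ ncols T
hd≤ncols {T = T} wf hd =
  subst (_ ≤_) (card-replicate-true _) (hd≤test wf (replicate (ncols T) true) (full-isTest T) hd)

hd≤Θ : ∀ {k} {T : Table (suc k)} {θ h} → WF T → ThetaIs T θ → HdIs T h → h ≤ θ
hd≤Θ wf ((D , test , refl) , _) hd = hd≤test wf D test hd

theorem2 : (k : ℕ) → 2 ≤ k → (A : Table k → Set) → ClosedClass A →
           SUnbounded A → (n : ℕ) → FWIs A n n × FΘIs A n n
theorem2 (suc zero) (s≤s ()) _ _ _ _
theorem2 (suc (suc k)) _ A closed@(wfA , _) unbounded n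
  with extremal-table closed unbounded n
... | U , AU , ncols≡n , hd≡n , Θ≡n =
  ((U , AU , ℕ.≤-reflexive ncols≡n , hd≡n) ,
   λ T AT W≤n _ hd → ℕ.≤-trans (hd≤ncols (wfA T AT) hd) W≤n) ,
  ((U , AU , (n , Θ≡n , ℕ.≤-refl) , hd≡n) ,
   λ T AT _ Θ θ≤n _ hd → ℕ.≤-trans (hd≤Θ (wfA T AT) Θ hd) θ≤n)
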